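{- Let $G$ be a $2$-connected multigraph that admits an interval coloring. Then $W(G)\leq 1+\left\lfloor \frac{|V(G)|}{2}\right\rfloor(\Delta(G)-1)$.
   Context: Multigraphs are finite and may have multiple edges but no loops. For a positive integer $t$, an interval $t$-coloring of a multigraph $G$ is a proper edge coloring $\alpha:E(G)\to\{1,\dots,t\}$ in which every color $1,\dots,t$ is used and, for every vertex $v$, the set of colors on the edges incident to $v$ is an interval of consecutive integers. For a multigraph $G$ having an interval coloring, $W(G)$ denotes the maximum $t$ such that $G$ has an interval $t$-coloring. $\Delta(G)$ is the maximum degree. -}

module Defs where

open import Data.Nat using (ℕ; zero; suc; _≤_; _⊔_)
open import Data.Fin using (Fin; _≟_)
open import Data.Product using (_×_; _,_; proj₁; proj₂; Σ; ∃)
open import Data.Sum using (_⊎_)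
open import Data.List using (List; length; filter; map; foldr; allFin)
open import Relation.Binary.PropositionalEquality using (_≡_; _≢_)
open import Relation.Nullary using (¬_; Dec)
open import Relation.Nullary.Decidable using (_⊎-dec_)

record Multigraph : Set where
  field
    n        : ℕ
    m        : ℕ
    ends     : Fin m → Fin n × Fin n
    loopless : ∀ e → proj₁ (ends e) ≢ proj₂ (ends e)
open Multigraph public

Incident : (G : Multigraph) → Fin (n G) → Fin (m G) → Set
Incident G v e = (v ≡ proj₁ (ends G e)) ⊎ (v ≡ proj₂ (ends G e))

incident? : (G : Multigraph) → (v : Fin (n G)) → (e : Fin (m G)) → Dec (Incident G v e)
incident? G v e = (v ≟ proj₁ (ends G e)) ⊎-dec (v ≟ proj₂ (ends G e))

degree : (G : Multigraph) → Fin (n G) → ℕ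
degree G v = length (filter (incident? G v) (allFin (m G)))

-- maximum degree Δ(G) (0 for the empty graph)
maxDegree : Multigraph → ℕ
maxDegree G = foldr _⊔_ 0 (map (degree G) (allFin (n G)))

Joins : (G : Multigraph) → Fin (m G) → Fin (n G) → Fin (n G) → Set
Joins G e u w = (ends G e ≡ (u , w)) ⊎ (ends G e ≡ (w , u))

data Walk (G : Multigraph) (ok : Fin (n G) → Set) : Fin (n G) → Fin (n G) → Set where
  stop : ∀ {u} → ok u → Walk G ok u u
  step : ∀ {u w v} (e : Fin (m G)) → Joins G e u w → ok u → Walk G ok w v → Walk G ok u v

-- the subgraph induced on vertices satisfying ok is connected
ConnectedOn : (G : Multigraph) → (Fin (n G) → Set) → Set
ConnectedOn G ok = ∀ u v → ok u → ok v → Walk G ok u v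

-- 2-connected (Diestel): more than 2 vertices, connected, and
-- G - x is connected for every vertex x
TwoConnected : Multigraph → Set
TwoConnected G =
  (3 ≤ n G) × (ConnectedOn G (λ _ → Data.Unit.⊤))
    × (∀ (x : Fin (n G)) → ConnectedOn G (λ y → y ≢ x))
  where import Data.Unit

record IntervalColoring (G : Multigraph) (t : ℕ) : Set where
  field
    α        : Fin (m G) → ℕ
    inRange  : ∀ e → (1 ≤ α e) × (α e ≤ t)
    proper   : ∀ v e e' → Incident G v e → Incident G v e' → e ≢ e' → α e ≢ α e'
    allUsed  : ∀ c → 1 ≤ c → c ≤ t → ∃ λ e → α e ≡ c
    interval : ∀ v e e' c → Incident G v e → Incident G v e' → α e ≤ c → c ≤ α e' →
               ∃ λ e'' → Incident G v e'' × (α e'' ≡ c)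

HasIntervalColoring : Multigraph → Set
HasIntervalColoring G = ∃ λ t → IntervalColoring G t

module Submission where

-- Fix an interval t-colouring α and write D = Δ − 1.  Colours at a vertex form
-- an interval realised by distinct incident edges, so they span at most Δ
-- values: α e' < α e + Δ for edges e, e' at a common vertex.  Say v straddles
-- the level c if it has an incident edge of colour ≤ c and one of colour > c.
-- Consequently a vertex cannot straddle two levels that are D or more apart.
-- In a connected graph a walk from an edge of colour ≤ c to one of colour > c
-- passes a straddling vertex; in a 2-connected graph, deleting it and walking
-- again yields a second one.  If t > 1 + ⌊n/2⌋D, the ⌊n/2⌋ + 1 levels 1 + jD
-- (0 ≤ j ≤ ⌊n/2⌋) all lie below t, each has two straddling vertices, and all
-- these 2(⌊n/2⌋ + 1) > n vertices are distinct: a contradiction.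

open import Defs
open import Data.Nat using (ℕ; suc; _≤_; _<_; z≤n; s≤s; _≤?_; _<?_; _+_; _*_; _∸_; _/_; _%_; _⊔_)
open import Data.Nat.Properties
open import Data.Nat.DivMod using (m≡m%n+[m/n]*n; m%n<n)
open import Data.Fin as Fin using (Fin; toℕ; splitAt; join)
open import Data.Fin.Properties using (toℕ-injective; toℕ<n; join-splitAt; injective⇒≤)
  renaming (<-cmp to Fin-<-cmp)
open import Data.Product using (Σ; ∃; _×_; _,_; proj₁; proj₂)
open import Data.Sum using (_⊎_; inj₁; inj₂)
open import Data.Empty using (⊥; ⊥-elim)
open import Data.Unit using (tt)
open import Data.List using (List; _∷_; filter; foldr; allFin)
open import Data.List.Membership.Propositional using (_∈_)
open import Data.List.Membership.Propositional.Properties using (∈-filter⁺; ∈-allFin; ∈-map⁺)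
open import Data.List.Membership.Setoid.Properties using (index-injective)
open import Data.List.Relation.Unary.Any as Any using (here; there)
open import Function.Definitions using (Injective)
open import Relation.Binary using (tri<; tri≈; tri>)
open import Relation.Binary.PropositionalEquality
open import Relation.Nullary using (yes; no)

≤-foldr-max : ∀ {x} (xs : List ℕ) → x ∈ xs → x ≤ foldr _⊔_ 0 xs
≤-foldr-max (y ∷ ys) (here refl) = m≤m⊔n y _
≤-foldr-max (y ∷ ys) (there x∈ys) = ≤-trans (≤-foldr-max ys x∈ys) (m≤n⊔m y _)

n<2[n/2+1] : ∀ n → n < suc (n / 2) + suc (n / 2)
n<2[n/2+1] n = s≤s (begin
  n                     ≡⟨ m≡m%n+[m/n]*n n 2 ⟩
  n % 2 + k * 2         ≤⟨ +-monoˡ-≤ (k * 2) (≤-pred (m%n<n n 2)) ⟩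
  suc (k * 2)           ≡⟨ cong suc (trans (*-comm k 2) (cong (k +_) (+-identityʳ k))) ⟩
  suc (k + k)           ≡⟨ +-suc k k ⟨
  k + suc k             ∎)
  where
  open ≤-Reasoning
  k = n / 2

-- splitAt is injective, being inverted by join.
splitAt-injective : ∀ a b → Injective _≡_ _≡_ (splitAt a {b})
splitAt-injective a b {i} {j} eq = begin
  i                      ≡⟨ join-splitAt a b i ⟨
  join a b (splitAt a i) ≡⟨ cong (join a b) eq ⟩
  join a b (splitAt a j) ≡⟨ join-splitAt a b j ⟩
  j                      ∎
  where open ≡-Reasoning

module _ (G : Multigraph) where

  Inc : Fin (n G) → Fin (m G) → Set
  Inc = Incident G

  degree≤maxDegree : ∀ v → degree G v ≤ maxDegree G
  degree≤maxDegree v = ≤-foldr-max _ (∈-map⁺ (degree G) (∈-allFin v))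

  -- A family of K distinct edges incident to v has K ≤ deg v: sending each edge
  -- to its position in the list of edges at v is injective.
  injective-incident⇒≤degree : ∀ v {K} (g : Fin K → Fin (m G)) → (∀ i → Inc v (g i)) →
                               Injective _≡_ _≡_ g → K ≤ degree G v
  injective-incident⇒≤degree v g g-inc g-inj =
    injective⇒≤ {f = λ i → Any.index (position i)}
      (λ {i} {j} eq → g-inj (index-injective (setoid _) (position i) (position j) eq))
    where
    position : ∀ i → g i ∈ filter (incident? G v) (allFin (m G))
    position i = ∈-filter⁺ (incident? G v) (∈-allFin (g i)) (g-inc i)

  joins⇒incident : ∀ {e u w} → Joins G e u w → Inc u e × Inc w e
  joins⇒incident (inj₁ eq) = inj₁ (cong proj₁ (sym eq)) , inj₂ (cong proj₂ (sym eq))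
  joins⇒incident (inj₂ eq) = inj₂ (cong proj₂ (sym eq)) , inj₁ (cong proj₁ (sym eq))

  endpointAvoiding : ∀ e x → ∃ λ a → a ≢ x × Inc a e
  endpointAvoiding e x with proj₁ (ends G e) Fin.≟ x
  ... | no  end₁≢x = _ , end₁≢x , inj₁ refl
  ... | yes end₁≡x = _ , (λ end₂≡x → loopless G e (trans end₁≡x (sym end₂≡x))) , inj₂ refl

  module _ {t : ℕ} (C : IntervalColoring G t) where
    open IntervalColoring C

    -- Colours at a vertex span fewer than Δ values: otherwise the interval
    -- property yields Δ + 1 distinct incident edges coloured α e, …, α e + Δ.
    colourWindow : ∀ {v e e'} → Inc v e → Inc v e' → α e' < α e + maxDegree G
    colourWindow {v} {e} {e'} ie ie' with α e + maxDegree G ≤? α e'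
    ... | no  ≰ = ≰⇒> ≰
    ... | yes window≤ = ⊥-elim (1+n≰n (≤-trans
          (injective-incident⇒≤degree v edgeOf (λ i → proj₁ (proj₂ (colourAt i))) edgeOf-injective)
          (degree≤maxDegree v)))
      where
      colourAt : (i : Fin (suc (maxDegree G))) → ∃ λ f → Inc v f × (α f ≡ α e + toℕ i)
      colourAt i = interval v e e' (α e + toℕ i) ie ie' (m≤m+n _ _)
                     (≤-trans (+-monoʳ-≤ (α e) (≤-pred (toℕ<n i))) window≤)
      edgeOf : Fin (suc (maxDegree G)) → Fin (m G)
      edgeOf i = proj₁ (colourAt i)
      edgeOf-injective : Injective _≡_ _≡_ edgeOf
      edgeOf-injective {i} {j} eq = toℕ-injective (+-cancelˡ-≡ (α e) _ _
        (trans (sym (proj₂ (proj₂ (colourAt i))))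
               (trans (cong α eq) (proj₂ (proj₂ (colourAt j))))))

    Low High Straddles : Fin (n G) → ℕ → Set
    Low v c = ∃ λ e → Inc v e × α e ≤ c
    High v c = ∃ λ e → Inc v e × c < α e
    Straddles v c = Low v c × High v c

    D : ℕ
    D = maxDegree G ∸ 1

    lowHighGap : ∀ {v c c'} → Low v c → High v c' → c' < c + D
    lowHighGap {c = c} {c'} (e , ie , αe≤c) (e' , ie' , c'<αe') = ≤-pred (begin
      suc (suc c')        ≤⟨ s≤s c'<αe' ⟩
      suc (α e')          ≤⟨ colourWindow ie ie' ⟩
      α e + maxDegree G   ≤⟨ +-mono-≤ αe≤c (m≤n+m∸n (maxDegree G) 1) ⟩
      c + suc D           ≡⟨ +-suc c D ⟩
      suc (c + D)         ∎)
      where open ≤-Reasoning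

    -- Along a walk from a vertex low at c to a vertex high at c, the first
    -- edge coloured above c is entered from a straddling vertex.
    walk⇒straddler : ∀ {ok a b} c → Walk G ok a b → Low a c → High b c →
                     ∃ λ v → ok v × Straddles v c
    walk⇒straddler c (stop ok-a) low high = _ , ok-a , low , high
    walk⇒straddler c (step e j ok-a w) low high with c <? α e
    ... | yes c<αe = _ , ok-a , low , (e , proj₁ (joins⇒incident j) , c<αe)
    ... | no  c≮αe = walk⇒straddler c w (e , proj₂ (joins⇒incident j) , ≮⇒≥ c≮αe) high

    -- In a 2-connected graph, a level separating two edge colours is straddled
    -- by two distinct vertices: one on a walk in G, one on a walk in G - x.
    twoStraddlers : TwoConnected G → ∀ {c e₋ e₊} → α e₋ ≤ c → c < α e₊ →
                    Σ (Fin (n G)) λ x → Σ (Fin (n G)) λ y → x ≢ y × Straddles x c × Straddles y c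
    twoStraddlers (_ , connected , connected-x) {c} {e₋} {e₊} αe₋≤c c<αe₊ =
      x , y , (λ x≡y → y≢x (sym x≡y)) , x-straddles , y-straddles
      where
      first = walk⇒straddler c (connected _ _ tt tt) (e₋ , inj₁ refl , αe₋≤c) (e₊ , inj₁ refl , c<αe₊)
      x = proj₁ first
      x-straddles = proj₂ (proj₂ first)
      a = endpointAvoiding e₋ x
      b = endpointAvoiding e₊ x
      second = walk⇒straddler c (connected-x x _ _ (proj₁ (proj₂ a)) (proj₁ (proj₂ b)))
                 (e₋ , proj₂ (proj₂ a) , αe₋≤c) (e₊ , proj₂ (proj₂ b) , c<αe₊)
      y = proj₁ second
      y≢x = proj₁ (proj₂ second)
      y-straddles = proj₂ (proj₂ second)

    level : ∀ {k} → Fin k → ℕ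
    level j = suc (toℕ j * D)

    levelsApart : ∀ {k} {a b : Fin k} → a Fin.< b → level a + D ≤ level b
    levelsApart {a = a} {b} a<b = begin
      suc (toℕ a * D) + D    ≡⟨ cong suc (+-comm (toℕ a * D) D) ⟩
      suc (suc (toℕ a) * D)  ≤⟨ s≤s (*-monoˡ-≤ D a<b) ⟩
      suc (toℕ b * D)        ∎
      where open ≤-Reasoning

    -- By the gap bound, a vertex straddles at most one level.
    straddledLevel-unique : ∀ {v k} {a b : Fin k} →
                            Straddles v (level a) → Straddles v (level b) → a ≡ b
    straddledLevel-unique {a = a} {b} (low-a , high-a) (low-b , high-b) with Fin-<-cmp a b
    ... | tri< a<b _ _ = ⊥-elim (<⇒≱ (lowHighGap low-a high-b) (levelsApart a<b))
    ... | tri≈ _ a≡b _ = a≡b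
    ... | tri> _ _ b<a = ⊥-elim (<⇒≱ (lowHighGap low-b high-a) (levelsApart b<a))

    -- If t > 1 + ⌊n/2⌋D, the levels 1 + jD (j ≤ ⌊n/2⌋) lie strictly between the
    -- colours 1 and t, so each has two straddlers, and these are all distinct.
    module _ (tc : TwoConnected G) (t-large : 1 + (n G / 2) * D < t) where

      Level : Set
      Level = Fin (suc (n G / 2))

      1≤t : 1 ≤ t
      1≤t = ≤-trans (s≤s z≤n) t-large

      level<t : (j : Level) → level j < t
      level<t j = ≤-trans (s≤s (s≤s (*-monoˡ-≤ D (≤-pred (toℕ<n j))))) t-large

      straddlersAt : (j : Level) → Σ (Fin (n G)) λ x → Σ (Fin (n G)) λ y →
                     x ≢ y × Straddles x (level j) × Straddles y (level j)
      straddlersAt j with allUsed 1 ≤-refl 1≤t | allUsed t 1≤t ≤-refl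
      ... | e₁ , αe₁≡1 | eₜ , αeₜ≡t =
        twoStraddlers tc (subst (_≤ level j) (sym αe₁≡1) (s≤s z≤n))
                         (subst (level j <_) (sym αeₜ≡t) (level<t j))

      straddler : Level ⊎ Level → Fin (n G)
      straddler (inj₁ j) = proj₁ (straddlersAt j)
      straddler (inj₂ j) = proj₁ (proj₂ (straddlersAt j))

      levelOf : Level ⊎ Level → Level
      levelOf (inj₁ j) = j
      levelOf (inj₂ j) = j

      straddler-straddles : ∀ s → Straddles (straddler s) (level (levelOf s))
      straddler-straddles (inj₁ j) = proj₁ (proj₂ (proj₂ (proj₂ (straddlersAt j))))
      straddler-straddles (inj₂ j) = proj₂ (proj₂ (proj₂ (proj₂ (straddlersAt j))))

      sameLevel : ∀ {s s'} → straddler s ≡ straddler s' → levelOf s ≡ levelOf s'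
      sameLevel {s} {s'} eq = straddledLevel-unique (straddler-straddles s)
        (subst (λ v → Straddles v (level (levelOf s'))) (sym eq) (straddler-straddles s'))

      -- Distinct indices give distinct vertices: at different levels by
      -- straddledLevel-unique, at the same level because x ≢ y.
      straddler-injective : Injective _≡_ _≡_ straddler
      straddler-injective {inj₁ a} {inj₁ b} eq = cong inj₁ (sameLevel {inj₁ a} {inj₁ b} eq)
      straddler-injective {inj₂ a} {inj₂ b} eq = cong inj₂ (sameLevel {inj₂ a} {inj₂ b} eq)
      straddler-injective {inj₁ a} {inj₂ b} eq with sameLevel {inj₁ a} {inj₂ b} eq
      ... | refl = ⊥-elim (proj₁ (proj₂ (proj₂ (straddlersAt a))) eq)
      straddler-injective {inj₂ a} {inj₁ b} eq with sameLevel {inj₂ a} {inj₁ b} eq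
      ... | refl = ⊥-elim (proj₁ (proj₂ (proj₂ (straddlersAt a))) (sym eq))

      tooManyStraddlers : ⊥
      tooManyStraddlers = <⇒≱ (n<2[n/2+1] (n G))
        (injective⇒≤ (λ eq → splitAt-injective (suc (n G / 2)) (suc (n G / 2)) (straddler-injective eq)))

mainTheorem12 : (G : Multigraph) → TwoConnected G → HasIntervalColoring G →
    ∀ (t : ℕ) → IntervalColoring G t → t ≤ 1 + (n G / 2) * (maxDegree G ∸ 1)
mainTheorem12 G tc _ t C with t ≤? 1 + (n G / 2) * (maxDegree G ∸ 1)
... | yes t≤bound = t≤bound
... | no  t≰bound = ⊥-elim (tooManyStraddlers G C tc (≰⇒> t≰bound))
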